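{- Let $F$ be an hke collection with $\alpha=\alpha(F)$ and let $A\in F$. Then the function $f_A:F\to\mathcal P(A)$ defined by $f_A(D)=A\cap D$ is injective. Consequently $|F|\le 2^{\alpha}$.
   Context: A non-empty finite collection $F$ of finite sets is an \emph{hke collection} if there is a positive integer $\alpha$ such that $|\bigcup \Gamma|+|\bigcap \Gamma|=2\alpha$ for every non-empty subcollection $\Gamma\subseteq F$; this $\alpha$ is $\alpha(F)$. $\mathcal P(A)$ is the power set of $A$. -}

module Defs where

open import Data.Nat using (ℕ; _*_; _<_)
open import Data.List using (List; [])
open import Data.List.Relation.Unary.All using (All)
open import Data.List.Membership.Propositional using (_∈_)
open import Data.Fin.Subset using (Subset; ⋃; ⋂; ∣_∣)
open import Data.Nat using (_+_)
open import Data.Product using (_×_)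
open import Relation.Binary.PropositionalEquality using (_≡_; _≢_)

-- Finite sets are modelled as subsets of a common finite ground set Fin n.
-- A finite collection F is a duplicate-free list of such subsets
-- (duplicate-freeness is imposed in the theorem statement).
-- A non-empty subcollection Γ ⊆ F is given by a non-empty list of members of F
-- (repetitions in Γ do not affect ⋃ Γ or ⋂ Γ).

IsHke : ∀ {n} → List (Subset n) → ℕ → Set
IsHke {n} F α =
  (F ≢ []) × (0 < α) ×
  ((Γ : List (Subset n)) → Γ ≢ [] → All (_∈ F) Γ →
     ∣ ⋃ Γ ∣ + ∣ ⋂ Γ ∣ ≡ 2 * α)

-- If A ∩ D = A ∩ D′, the collections {A, D} and {A, D, D′} have the same intersection,
-- so by the hke identity their unions have the same size; as one contains the other they
-- are equal, whence D′ ⊆ A ∪ D and then D′ ⊆ D. So D ↦ A ∩ D embeds F into the subsets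
-- of A, and |A| = α is the hke identity for Γ = {A}.
module Submission where

open import Defs
open import Data.Nat using (ℕ; _≤_; _^_)
open import Data.List using (List; length)
open import Data.List.Relation.Unary.Unique.Propositional using (Unique)
open import Data.List.Membership.Propositional using (_∈_)
open import Data.Fin.Subset using (Subset; _∩_)
open import Data.Product using (_×_)
open import Relation.Binary.PropositionalEquality using (_≡_)

open import Data.Bool using (Bool; true; false; _≟_)
open import Data.Empty using (⊥-elim)
open import Data.Fin.Subset using (_∪_; _⊆_; ∣_∣; ⋃; ⋂; ⊤; inside; outside)
  renaming (_∈_ to _∈ˢ_)
open import Data.Fin.Subset.Properties
open import Data.List using ([]; _∷_; _++_; map)
open import Data.List.Membership.Propositional.Properties using (∈-++⁺ˡ)
open import Data.List.Properties using (length-map)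
open import Data.List.Relation.Unary.All using (All; []; _∷_)
import Data.List.Relation.Unary.All as All
import Data.List.Relation.Unary.All.Properties as Allₚ
open import Data.List.Relation.Unary.AllPairs using ([]; _∷_)
open import Data.Vec using ([]; _∷_; here)
open import Data.List.Relation.Unary.Any using (here; there)
open import Data.List.Relation.Unary.Unique.Propositional.Properties
  using (Unique[x∷xs]⇒x∉xs)
open import Data.Nat using (suc; _+_; _*_; z≤n; s≤s)
open import Data.Nat.Properties
  using (+-mono-≤; +-suc; +-cancelʳ-≡; *-cancelˡ-≡; +-identityʳ; <-irrefl; module ≤-Reasoning)
open import Data.Product using (∃; _,_; proj₂)
open import Data.Sum using (inj₁; inj₂)
open import Function using (_∘_)
open import Level using (Level)
open import Relation.Nullary using (yes; no)
open import Relation.Binary.PropositionalEquality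
  using (_≢_; refl; sym; trans; cong; cong₂; subst; module ≡-Reasoning)

private
  variable
    a b : Level
    A : Set a
    B : Set b
    n : ℕ

p⊆q⇒∣p∣≡∣q∣⇒q⊆p : {p q : Subset n} → p ⊆ q → ∣ p ∣ ≡ ∣ q ∣ → q ⊆ p
p⊆q⇒∣p∣≡∣q∣⇒q⊆p {p = p} p⊆q ∣p∣≡∣q∣ {x} x∈q with x ∈? p
... | yes x∈p = x∈p
... | no  x∉p = ⊥-elim (<-irrefl ∣p∣≡∣q∣ (p⊂q⇒∣p∣<∣q∣ (p⊆q , x , x∈q , x∉p)))

∈⋃⁺ : ∀ {x} {p : Subset n} {Γ} → p ∈ Γ → x ∈ˢ p → x ∈ˢ ⋃ Γ
∈⋃⁺ (here refl) x∈p = x∈p∪q⁺ (inj₁ x∈p)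
∈⋃⁺ (there p∈Γ) x∈p = x∈p∪q⁺ (inj₂ (∈⋃⁺ p∈Γ x∈p))

∈⋃⁻ : ∀ {x} (Γ : List (Subset n)) → x ∈ˢ ⋃ Γ → ∃ λ p → p ∈ Γ × x ∈ˢ p
∈⋃⁻ [] x∈⊥ = ⊥-elim (∉⊥ x∈⊥)
∈⋃⁻ (p ∷ Γ) x∈⋃ with x∈p∪q⁻ p (⋃ Γ) x∈⋃
... | inj₁ x∈p = p , here refl , x∈p
... | inj₂ x∈⋃Γ with ∈⋃⁻ Γ x∈⋃Γ
...   | q , q∈Γ , x∈q = q , there q∈Γ , x∈q

⋃-⊆-++ : (Γ Δ : List (Subset n)) → ⋃ Γ ⊆ ⋃ (Γ ++ Δ)
⋃-⊆-++ Γ Δ x∈⋃Γ with ∈⋃⁻ Γ x∈⋃Γ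
... | p , p∈Γ , x∈p = ∈⋃⁺ (∈-++⁺ˡ p∈Γ) x∈p

∩-cancel-⊆ : (p q r : Subset n) → p ∩ q ≡ p ∩ r → r ⊆ p ∪ q → r ⊆ q
∩-cancel-⊆ p q r p∩q≡p∩r r⊆p∪q {x} x∈r with x∈p∪q⁻ p q (r⊆p∪q x∈r)
... | inj₂ x∈q = x∈q
... | inj₁ x∈p = proj₂ (x∈p∩q⁻ p q (subst (x ∈ˢ_) (sym p∩q≡p∩r) (x∈p∩q⁺ (x∈p , x∈r))))

unique-map⁺ : {f : A → B} {xs : List A} → (∀ {x y} → x ∈ xs → y ∈ xs → f x ≡ f y → x ≡ y) →
              Unique xs → Unique (map f xs)
unique-map⁺ {xs = []}     _   []              = []
unique-map⁺ {xs = x ∷ xs} inj u@(_ ∷ xs-unique) =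
  Allₚ.map⁺ (All.tabulate λ y∈xs fx≡fy →
    Unique[x∷xs]⇒x∉xs u (subst (_∈ xs) (sym (inj (here refl) (there y∈xs) fx≡fy)) y∈xs))
  ∷ unique-map⁺ (λ x∈ y∈ → inj (there x∈) (there y∈)) xs-unique

withHead : Bool → List (Subset (suc n)) → List (Subset n)
withHead b []             = []
withHead b ((c ∷ p) ∷ G) with b ≟ c
... | yes _ = p ∷ withHead b G
... | no  _ = withHead b G

length-withHead : (G : List (Subset (suc n))) →
                  length G ≡ length (withHead true G) + length (withHead false G)
length-withHead []                = refl
length-withHead ((true  ∷ p) ∷ G) = cong suc (length-withHead G)
length-withHead ((false ∷ p) ∷ G) = trans (cong suc (length-withHead G)) (sym (+-suc _ _))

∈-withHead : ∀ b (G : List (Subset (suc n))) {q} → q ∈ withHead b G → (b ∷ q) ∈ G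
∈-withHead b ((c ∷ p) ∷ G) q∈ with b ≟ c | q∈
... | yes refl | here refl = here refl
... | yes refl | there q∈′ = there (∈-withHead b G q∈′)
... | no  _    | q∈′       = there (∈-withHead b G q∈′)

withHead-unique : ∀ b {G : List (Subset (suc n))} → Unique G → Unique (withHead b G)
withHead-unique b {[]}            []              = []
withHead-unique b {(c ∷ p) ∷ G} u@(_ ∷ G-unique) with b ≟ c
... | yes refl = Allₚ.¬Any⇒All¬ _ (Unique[x∷xs]⇒x∉xs u ∘ ∈-withHead b G)
               ∷ withHead-unique b G-unique
... | no  _    = withHead-unique b G-unique

withHead-⊆ : ∀ b {s} {p : Subset n} {G} → All (_⊆ s ∷ p) G → All (_⊆ p) (withHead b G)
withHead-⊆ b {G = []}            []          = []
withHead-⊆ b {G = (c ∷ q) ∷ G} (cq⊆sp ∷ G⊆) with b ≟ c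
... | yes refl = drop-∷-⊆ cq⊆sp ∷ withHead-⊆ b G⊆
... | no  _    = withHead-⊆ b G⊆

withHead-⊆-outside : {p : Subset n} {G : List (Subset (suc n))} →
                     All (_⊆ outside ∷ p) G → withHead true G ≡ []
withHead-⊆-outside {G = []}                []          = refl
withHead-⊆-outside {G = (true  ∷ q) ∷ G} (tq⊆op ∷ _)  with () ← tq⊆op here
withHead-⊆-outside {G = (false ∷ q) ∷ G} (_ ∷ G⊆)     = withHead-⊆-outside G⊆

unique-⊆⇒length≤2^∣p∣ : (p : Subset n) {G : List (Subset n)} → Unique G → All (_⊆ p) G →
                        length G ≤ 2 ^ ∣ p ∣
unique-⊆⇒length≤2^∣p∣ [] {[]}              _                _ = z≤n
unique-⊆⇒length≤2^∣p∣ [] {[] ∷ []}         _                _ = s≤s z≤n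
unique-⊆⇒length≤2^∣p∣ [] {[] ∷ [] ∷ _}    ((≢[] ∷ _) ∷ _) _ = ⊥-elim (≢[] refl)
unique-⊆⇒length≤2^∣p∣ (inside ∷ p) {G} G-unique G⊆ = begin
  length G                                              ≡⟨ length-withHead G ⟩
  length (withHead true G) + length (withHead false G)  ≤⟨ +-mono-≤ (bound true) (bound false) ⟩
  2 ^ ∣ p ∣ + 2 ^ ∣ p ∣                                 ≡⟨ cong (2 ^ ∣ p ∣ +_) (+-identityʳ _) ⟨
  2 ^ suc ∣ p ∣                                         ∎
  where
  open ≤-Reasoning
  bound : ∀ b → length (withHead b G) ≤ 2 ^ ∣ p ∣
  bound b = unique-⊆⇒length≤2^∣p∣ p (withHead-unique b G-unique) (withHead-⊆ b G⊆)
unique-⊆⇒length≤2^∣p∣ (outside ∷ p) {G} G-unique G⊆ = begin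
  length G                                              ≡⟨ length-withHead G ⟩
  length (withHead true G) + length (withHead false G)  ≡⟨ cong (λ H → length H + length (withHead false G)) no-inside ⟩
  length (withHead false G)                             ≤⟨ bound ⟩
  2 ^ ∣ p ∣                                             ∎
  where
  open ≤-Reasoning
  no-inside : withHead true G ≡ []
  no-inside = withHead-⊆-outside G⊆
  bound : length (withHead false G) ≤ 2 ^ ∣ p ∣
  bound = unique-⊆⇒length≤2^∣p∣ p (withHead-unique false G-unique) (withHead-⊆ false G⊆)

module _ {F : List (Subset n)} {α : ℕ} (hke : IsHke F α) where

  open ≡-Reasoning

  private
    ∣⋃∣+∣⋂∣≡2α : (Γ : List (Subset n)) → Γ ≢ [] → All (_∈ F) Γ → ∣ ⋃ Γ ∣ + ∣ ⋂ Γ ∣ ≡ 2 * α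
    ∣⋃∣+∣⋂∣≡2α = proj₂ (proj₂ hke)

  ∈⇒∣p∣≡α : {A : Subset n} → A ∈ F → ∣ A ∣ ≡ α
  ∈⇒∣p∣≡α {A} A∈F = *-cancelˡ-≡ ∣ A ∣ α 2 (begin
    2 * ∣ A ∣                 ≡⟨ cong (∣ A ∣ +_) (+-identityʳ ∣ A ∣) ⟩
    ∣ A ∣ + ∣ A ∣             ≡⟨ cong₂ (λ X Y → ∣ X ∣ + ∣ Y ∣) (∪-identityʳ A) (∩-identityʳ A) ⟨
    ∣ ⋃ Γ ∣ + ∣ ⋂ Γ ∣         ≡⟨ ∣⋃∣+∣⋂∣≡2α Γ (λ ()) (A∈F ∷ []) ⟩
    2 * α                     ∎)
    where
    Γ : List (Subset n)
    Γ = A ∷ []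

  ⋂≡⋂⇒∣⋃∣≡∣⋃∣ : {Γ Δ : List (Subset n)} →
                Γ ≢ [] → All (_∈ F) Γ → Δ ≢ [] → All (_∈ F) Δ →
                ⋂ Γ ≡ ⋂ Δ → ∣ ⋃ Γ ∣ ≡ ∣ ⋃ Δ ∣
  ⋂≡⋂⇒∣⋃∣≡∣⋃∣ {Γ} {Δ} Γ≢[] Γ⊆F Δ≢[] Δ⊆F ⋂Γ≡⋂Δ = +-cancelʳ-≡ ∣ ⋂ Γ ∣ _ _ (begin
    ∣ ⋃ Γ ∣ + ∣ ⋂ Γ ∣  ≡⟨ ∣⋃∣+∣⋂∣≡2α Γ Γ≢[] Γ⊆F ⟩
    2 * α              ≡⟨ ∣⋃∣+∣⋂∣≡2α Δ Δ≢[] Δ⊆F ⟨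
    ∣ ⋃ Δ ∣ + ∣ ⋂ Δ ∣  ≡⟨ cong (λ I → ∣ ⋃ Δ ∣ + ∣ I ∣) ⋂Γ≡⋂Δ ⟨
    ∣ ⋃ Δ ∣ + ∣ ⋂ Γ ∣  ∎)

  ∩-injective-⊆ : {A D D′ : Subset n} → A ∈ F → D ∈ F → D′ ∈ F → A ∩ D ≡ A ∩ D′ → D′ ⊆ D
  ∩-injective-⊆ {A} {D} {D′} A∈F D∈F D′∈F A∩D≡A∩D′ = ∩-cancel-⊆ A D D′ A∩D≡A∩D′ D′⊆A∪D
    where
    Γ Δ : List (Subset n)
    Γ = A ∷ D ∷ []
    Δ = Γ ++ D′ ∷ []

    ⋂Γ≡⋂Δ : ⋂ Γ ≡ ⋂ Δ
    ⋂Γ≡⋂Δ = begin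
      A ∩ (D ∩ ⊤)          ≡⟨ cong (A ∩_) (∩-identityʳ D) ⟩
      A ∩ D                ≡⟨ A∩D≡A∩D′ ⟩
      A ∩ D′               ≡⟨ cong (A ∩_) (∩-idem D′) ⟨
      A ∩ (D′ ∩ D′)        ≡⟨ ∩-assoc A D′ D′ ⟨
      (A ∩ D′) ∩ D′        ≡⟨ cong (_∩ D′) A∩D≡A∩D′ ⟨
      (A ∩ D) ∩ D′         ≡⟨ ∩-assoc A D D′ ⟩
      A ∩ (D ∩ D′)         ≡⟨ cong (λ X → A ∩ (D ∩ X)) (∩-identityʳ D′) ⟨
      A ∩ (D ∩ (D′ ∩ ⊤))   ∎

    ⋃Δ⊆⋃Γ : ⋃ Δ ⊆ ⋃ Γ
    ⋃Δ⊆⋃Γ = p⊆q⇒∣p∣≡∣q∣⇒q⊆p (⋃-⊆-++ Γ (D′ ∷ []))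
      (⋂≡⋂⇒∣⋃∣≡∣⋃∣ (λ ()) (A∈F ∷ D∈F ∷ []) (λ ()) (A∈F ∷ D∈F ∷ D′∈F ∷ []) ⋂Γ≡⋂Δ)

    D′⊆A∪D : D′ ⊆ A ∪ D
    D′⊆A∪D x∈D′ with ∈⋃⁻ Γ (⋃Δ⊆⋃Γ (∈⋃⁺ {Γ = Δ} (there (there (here refl))) x∈D′))
    ... | _ , here refl , x∈A = x∈p∪q⁺ (inj₁ x∈A)
    ... | _ , there (here refl) , x∈D = x∈p∪q⁺ (inj₂ x∈D)

  ∩-injective : {A D D′ : Subset n} → A ∈ F → D ∈ F → D′ ∈ F → A ∩ D ≡ A ∩ D′ → D ≡ D′
  ∩-injective A∈F D∈F D′∈F A∩D≡A∩D′ =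
    ⊆-antisym (∩-injective-⊆ A∈F D′∈F D∈F (sym A∩D≡A∩D′)) (∩-injective-⊆ A∈F D∈F D′∈F A∩D≡A∩D′)

mainTheorem11 : (n : ℕ) (F : List (Subset n)) → Unique F →
    (α : ℕ) → IsHke F α → (A : Subset n) → A ∈ F →
    ((D D′ : Subset n) → D ∈ F → D′ ∈ F → A ∩ D ≡ A ∩ D′ → D ≡ D′)
    × (length F ≤ 2 ^ α)
mainTheorem11 n F F-unique α hke A A∈F = injective , bound
  where
  injective : (D D′ : Subset n) → D ∈ F → D′ ∈ F → A ∩ D ≡ A ∩ D′ → D ≡ D′
  injective _ _ = ∩-injective hke A∈F

  bound : length F ≤ 2 ^ α
  bound = begin
    length F              ≡⟨ length-map (A ∩_) F ⟨
    length (map (A ∩_) F) ≤⟨ unique-⊆⇒length≤2^∣p∣ A (unique-map⁺ (injective _ _) F-unique)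
                                 (Allₚ.map⁺ (All.universal (p∩q⊆p A) F)) ⟩
    2 ^ ∣ A ∣             ≡⟨ cong (2 ^_) (∈⇒∣p∣≡α hke A∈F) ⟩
    2 ^ α                 ∎
    where open ≤-Reasoning
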